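{- Let $\mathcal{M}$ be a minor-closed class of matroids and $\mathcal{M}^*=\{M^*: M\in\mathcal{M}\}$. Then the linear map $D\colon\mathcal{A}(\mathcal{M})\to\mathcal{A}(\mathcal{M}^*)$ determined by $M\mapsto M^*$ is an algebra antiisomorphism (bijective, unital, and $D(N_1\cdot N_2)=D(N_2)\cdot D(N_1)$). In particular, if $\mathcal{M}$ is closed under duality, $D$ is an antiautomorphism of $\mathcal{A}(\mathcal{M})$.
   Context: $\mathbb{K}$ is a commutative ring with unit; $M^*$ is the dual matroid. For matroids $N_1,N_2$ and $M=M(S)$, the section coefficient $\binom{M}{N_1,N_2}$ is the number of $A\subseteq S$ with $M|A\cong N_1$ and $M/A\cong N_2$. For a minor-closed class $\mathcal{M}$ of finite matroids, $\mathcal{A}(\mathcal{M})$ is the free $\mathbb{K}$-module with basis the isomorphism classes of matroids in $\mathcal{M}$ and product $N_1\cdot N_2=\sum_M\binom{M}{N_1,N_2}M$ (sum over isomorphism classes in $\mathcal{M}$), with unit the empty matroid. -}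

module Defs where

open import Level using (Level; _⊔_)
open import Data.Nat using (ℕ; zero; suc; _+_; _∸_; _≤_; _<_)
open import Data.Bool using (if_then_else_)
open import Data.Fin using (Fin; zero; suc)
open import Data.Fin.Properties using (any?)
open import Data.Fin.Subset
  using (Subset; Side; inside; outside; _∈_; _⊆_; _∪_; _∩_; _─_; ∣_∣)
open import Data.Fin.Subset.Properties using (_∈?_; _⊆?_; anySubset?)
open import Data.Vec using (Vec; []; _∷_; tabulate; lookup)
open import Data.Vec.Properties using (tabulate-cong)
open import Data.List using (List; []; _∷_; _++_; map; filter; length; foldr; deduplicate)
open import Data.Product using (Σ; ∃; _×_; _,_; proj₁; proj₂)
open import Function using (_∘_)
open import Relation.Nullary using (Dec; yes; no; ¬_; ¬?; does)
open import Relation.Nullary.Decidable using (map′; _×-dec_; _→-dec_; decidable-stable)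
open import Relation.Binary.PropositionalEquality
  using (_≡_; refl; sym; trans; cong; _≗_)
open import Data.Nat.Properties using (_≟_)
open import Algebra.Bundles using (CommutativeRing)

-- A (raw) matroid consists of an ambient finite set Fin n, a ground set
-- E ⊆ Fin n, and a rank function r (only its values on subsets of E
-- matter).

record RawMatroid : Set where
  constructor mkRaw
  field
    n    : ℕ
    E    : Subset n
    rank : Subset n → ℕ

open RawMatroid public

size : RawMatroid → ℕ
size M = ∣ E M ∣

record IsMatroid (M : RawMatroid) : Set where
  field
    r-card   : ∀ X → X ⊆ E M → rank M X ≤ ∣ X ∣
    r-mono   : ∀ X Y → X ⊆ Y → Y ⊆ E M → rank M X ≤ rank M Y
    r-submod : ∀ X Y → X ⊆ E M → Y ⊆ E M →
               rank M (X ∪ Y) + rank M (X ∩ Y) ≤ rank M X + rank M Y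

emptyMatroid : RawMatroid
emptyMatroid = mkRaw 0 [] (λ _ → 0)

restrict : (M : RawMatroid) → Subset (n M) → RawMatroid
restrict M A = mkRaw (n M) A (rank M)

contract : (M : RawMatroid) → Subset (n M) → RawMatroid
contract M A = mkRaw (n M) (E M ─ A) (λ X → rank M (X ∪ A) ∸ rank M A)

dual : RawMatroid → RawMatroid
dual M = mkRaw (n M) (E M) (λ X → (∣ X ∣ + rank M (E M ─ X)) ∸ rank M (E M))

preimage : ∀ {n m} → (Fin n → Fin m) → Subset m → Subset n
preimage f Y = tabulate (λ i → lookup Y (f i))

record IsIso (M N : RawMatroid) (f : Fin (n M) → Fin (n N))
             (g : Fin (n N) → Fin (n M)) : Set where
  constructor mkIsIso
  field
    f-maps : ∀ i → i ∈ E M → f i ∈ E N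
    g-maps : ∀ j → j ∈ E N → g j ∈ E M
    gf     : ∀ i → i ∈ E M → g (f i) ≡ i
    fg     : ∀ j → j ∈ E N → f (g j) ≡ j
    r-pres : ∀ Y → Y ⊆ E N → rank N Y ≡ rank M (E M ∩ preimage f Y)

infix 4 _≅_
_≅_ : RawMatroid → RawMatroid → Set
M ≅ N = Σ (Fin (n M) → Fin (n N)) λ f → Σ (Fin (n N) → Fin (n M)) λ g → IsIso M N f g

private
  allSubset? : ∀ {k} {P : Subset k → Set} → (∀ X → Dec (P X)) → Dec (∀ X → P X)
  allSubset? {P = P} P? with anySubset? (λ X → ¬? (P? X))
  ... | yes (X , ¬p) = no (λ h → ¬p (h X))
  ... | no ¬∃ = yes (λ X → decidable-stable (P? X) (λ ¬p → ¬∃ (X , ¬p)))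

  allFin? : ∀ {k} {P : Fin k → Set} → (∀ i → Dec (P i)) → Dec (∀ i → P i)
  allFin? {k} {P} P? with any? (λ i → ¬? (P? i))
  ... | yes (i , ¬p) = no (λ h → ¬p (h i))
  ... | no ¬∃ = yes (λ i → decidable-stable (P? i) (λ ¬p → ¬∃ (i , ¬p)))

  cons : ∀ {k m} → Fin m → (Fin k → Fin m) → Fin (suc k) → Fin m
  cons i h zero    = i
  cons i h (suc j) = h j

  ∃-fun? : ∀ k {m} {P : (Fin k → Fin m) → Set} →
           (∀ {f f'} → f ≗ f' → P f → P f') →
           (∀ f → Dec (P f)) → Dec (∃ P)
  fin0 : ∀ {m} → Fin zero → Fin m
  fin0 ()

  ∃-fun? zero {m} {P = P} resp P? =
    map′ (λ p → fin0 , p) (λ { (f , p) → resp {f} {fin0} (λ ()) p }) (P? fin0)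
  ∃-fun? (suc k) {m} {P} resp P? =
    map′ to from (any? (λ i → ∃-fun? k (resp' i) (λ h → P? (cons i h))))
    where
    resp' : ∀ i {h h' : Fin k → Fin m} → h ≗ h' → P (cons i h) → P (cons i h')
    resp' i eq = resp (λ { zero → refl ; (suc j) → eq j })
    to : (∃ λ i → ∃ λ h → P (cons i h)) → ∃ P
    to (i , h , p) = cons i h , p
    from : ∃ P → ∃ λ i → ∃ λ h → P (cons i h)
    from (f , p) = f zero , (λ j → f (suc j)) ,
                   resp (λ { zero → refl ; (suc j) → refl }) p

  isIso? : ∀ M N f g → Dec (IsIso M N f g)
  isIso? M N f g =
    map′ (λ { (a , b , c , d , e) → mkIsIso a b c d e })
         (λ { (mkIsIso a b c d e) → a , b , c , d , e })
      (allFin? (λ i → (i ∈? E M) →-dec (f i ∈? E N)) ×-dec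
       allFin? (λ j → (j ∈? E N) →-dec (g j ∈? E M)) ×-dec
       allFin? (λ i → (i ∈? E M) →-dec (Data.Fin.Properties._≟_ (g (f i)) i)) ×-dec
       allFin? (λ j → (j ∈? E N) →-dec (Data.Fin.Properties._≟_ (f (g j)) j)) ×-dec
       allSubset? (λ Y → (Y ⊆? E N) →-dec
                          (rank N Y ≟ rank M (E M ∩ preimage f Y))))

  resp-f : ∀ M N g {f f'} → f ≗ f' → IsIso M N f g → IsIso M N f' g
  resp-f M N g {f} {f'} eq (mkIsIso a b c d e) =
    mkIsIso (λ i p → subst' (eq i) (a i p)) b
            (λ i p → trans (cong g (sym (eq i))) (c i p))
            (λ j p → trans (sym (eq (g j))) (d j p))
            (λ Y p → trans (e Y p)
               (cong (λ Z → rank M (E M ∩ Z))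
                     (tabulate-cong (λ i → cong (lookup Y) (eq i)))))
    where
    subst' : ∀ {x y} → x ≡ y → x ∈ E N → y ∈ E N
    subst' refl p = p

  resp-g : ∀ M N f {g g'} → g ≗ g' → IsIso M N f g → IsIso M N f g'
  resp-g M N f {g} {g'} eq (mkIsIso a b c d e) =
    mkIsIso a (λ j p → subst' (eq j) (b j p))
            (λ i p → trans (sym (eq (f i))) (c i p))
            (λ j p → trans (cong f (sym (eq j))) (d j p)) e
    where
    subst' : ∀ {x y} → x ≡ y → x ∈ E M → y ∈ E M
    subst' refl p = p

_≅?_ : ∀ M N → Dec (M ≅ N)
M ≅? N =
  ∃-fun? (n M)
    (λ { eq (g , p) → g , resp-f M N g eq p })
    (λ f → ∃-fun? (n N) (λ eq p → resp-g M N f eq p) (λ g → isIso? M N f g))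

subsets : ∀ k → List (Subset k)
subsets zero    = [] ∷ []
subsets (suc k) = map (inside ∷_) (subsets k) ++ map (outside ∷_) (subsets k)

groundSubsets : (M : RawMatroid) → List (Subset (n M))
groundSubsets M = filter (λ A → A ⊆? E M) (subsets (n M))

sectionCoeff : RawMatroid → RawMatroid → RawMatroid → ℕ
sectionCoeff M N₁ N₂ =
  length (filter (λ A → (restrict M A ≅? N₁) ×-dec (contract M A ≅? N₂))
                 (groundSubsets M))

record MinorClosedClass (𝓜 : RawMatroid → Set) : Set₁ where
  field
    matroids     : ∀ M → 𝓜 M → IsMatroid M
    iso-closed   : ∀ M N → 𝓜 M → M ≅ N → 𝓜 N
    restr-closed : ∀ M A → 𝓜 M → A ⊆ E M → 𝓜 (restrict M A)
    contr-closed : ∀ M A → 𝓜 M → A ⊆ E M → 𝓜 (contract M A)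

DualClass : (RawMatroid → Set) → RawMatroid → Set
DualClass 𝓜 M = ∃ λ N → 𝓜 N × (M ≅ dual N)

-- An element Σ_[N] a_[N] [N] of the free K-module on the isomorphism
-- classes of 𝓜 is represented by its coefficient function
-- a : RawMatroid → K, which must be isomorphism-invariant on 𝓜 and
-- finitely supported (only finitely many classes, i.e. sizes bounded);
-- two elements are equal iff their coefficients agree on 𝓜.

module Algebra {c ℓ : Level} (K : CommutativeRing c ℓ) where
  open CommutativeRing K
    using (Carrier; _≈_; 0#; 1#)
    renaming (_+_ to _+K_; _*_ to _*K_)

  Coef : Set c
  Coef = RawMatroid → Carrier

  InA : (RawMatroid → Set) → Coef → Set ℓ
  InA 𝓜 x = (∀ M N → 𝓜 M → M ≅ N → x M ≈ x N)
          × (∃ λ b → ∀ M → 𝓜 M → b < size M → x M ≈ 0#)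

  Eq : (RawMatroid → Set) → Coef → Coef → Set ℓ
  Eq 𝓜 x y = ∀ M → 𝓜 M → x M ≈ y M

  _⊕_ : Coef → Coef → Coef
  (x ⊕ y) M = x M +K y M

  _•_ : Carrier → Coef → Coef
  (k • x) M = k *K x M

  basis : RawMatroid → Coef
  basis N M = if does (M ≅? N) then 1# else 0#

  unit : Coef
  unit = basis emptyMatroid

  fromℕ : ℕ → Carrier
  fromℕ zero    = 0#
  fromℕ (suc k) = 1# +K fromℕ k

  sumK : List Carrier → Carrier
  sumK = foldr _+K_ 0#

  sectionReps : (M : RawMatroid) → List (Subset (n M))
  sectionReps M =
    deduplicate
      (λ A A' → (restrict M A ≅? restrict M A') ×-dec (contract M A ≅? contract M A'))
      (groundSubsets M)

  -- product:  x · y = Σ_{N₁,N₂} x_{N₁} y_{N₂} N₁·N₂ , i.e. its coefficient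
  -- at M is Σ_{N₁,N₂} x_{N₁} y_{N₂} (M ; N₁ , N₂), the sum running over the
  -- pairs of classes (N₁,N₂) with nonzero section coefficient.
  _·_ : Coef → Coef → Coef
  (x · y) M =
    sumK (map (λ A → (x (restrict M A) *K y (contract M A))
                     *K fromℕ (sectionCoeff M (restrict M A) (contract M A)))
              (sectionReps M))

  record IsDualAntiIso (𝓜 𝓝 : RawMatroid → Set) (D : Coef → Coef) : Set (c ⊔ ℓ) where
    field
      into       : ∀ x → InA 𝓜 x → InA 𝓝 (D x)
      well-def   : ∀ x y → InA 𝓜 x → InA 𝓜 y → Eq 𝓜 x y → Eq 𝓝 (D x) (D y)
      additive   : ∀ x y → InA 𝓜 x → InA 𝓜 y → Eq 𝓝 (D (x ⊕ y)) (D x ⊕ D y)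
      homogen    : ∀ k x → InA 𝓜 x → Eq 𝓝 (D (k • x)) (k • D x)
      on-basis   : ∀ N → 𝓜 N → Eq 𝓝 (D (basis N)) (basis (dual N))
      injective  : ∀ x y → InA 𝓜 x → InA 𝓜 y → Eq 𝓝 (D x) (D y) → Eq 𝓜 x y
      surjective : ∀ z → InA 𝓝 z → ∃ λ x → InA 𝓜 x × Eq 𝓝 (D x) z
      unital     : Eq 𝓝 (D unit) unit
      anti-mult  : ∀ x y → InA 𝓜 x → InA 𝓜 y → Eq 𝓝 (D (x · y)) (D y · D x)

module Submission where

-- D is induced by the involution M ↦ M*, which respects isomorphism and satisfies M ≅ M** on
-- matroids; so D is well defined and bijective, and it is unital since the empty matroid is
-- self-dual.  The coefficient of Q in x · y is Σ_{A ⊆ E(Q)} x(Q|A) y(Q/A).  As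
-- (M*)|(E ∖ A) ≅ (M/A)* and (M*)/(E ∖ A) ≅ (M|A)*, substituting B = E ∖ A in the coefficient
-- Σ_B x(M*|B) y(M*/B) of M* in x · y gives Σ_A y((M|A)*) x((M/A)*), the coefficient of M in
-- D y · D x.  Only three facts about the target class 𝓝 are used: it consists of matroids and
-- duality maps 𝓝 into 𝓜 and 𝓜 into 𝓝; both 𝓜* and a duality-closed 𝓜 qualify.

open import Defs
open import Level using (Level)
open import Data.Nat using (ℕ; suc; _+_; _∸_; _≤_; z≤n; s≤s)
import Data.Nat.Properties as ℕ
open import Data.Nat.Properties
  using ( +-suc; m+[n∸m]≡n; [m+n]∸[m+o]≡n∸o; m+n∸m≡n
        ; +-∸-assoc; m≤n+o⇒m∸n≤o; +-monoʳ-≤; ≤-trans; ≤-antisym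
        ; ∸-monoˡ-≤; n≤0⇒n≡0; m∸n+n≡m; +-cancelʳ-≤; m≤m+n; m≤n+m)
open import Data.Bool using (true; false; if_then_else_)
open import Data.List using (List; []; _∷_; _++_; map; filter; length; deduplicate)
open import Data.List.Properties using (map-∘; filter-++; filter-≐; filter-none)
open import Data.List.Relation.Unary.All using (All; []; _∷_; universal)
import Data.List.Relation.Unary.All as All
open import Data.List.Relation.Unary.All.Properties using (all-filter)
open import Relation.Binary.Structures using (IsEquivalence)
open import Data.Fin using (Fin; zero; suc)
open import Data.Fin.Properties using (suc-injective)
open import Data.Fin.Subset
  using (Subset; inside; outside; _∈_; _∉_; _⊆_; _∪_; _∩_; _─_; _-_; ∣_∣)
open import Data.Fin.Subset.Properties
  using ( _⊆?_; ⊆-antisym; drop-∷-⊆; in⊆in; out⊆; x∈p∩q⁺; x∈p∩q⁻; x∈p∪q⁻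
        ; x∈p∧x∉q⇒x∈p─q; p⊆p∪q; q⊆p∪q; p∩q⊆p; p∩q⊆q; x∈p∧x≢y⇒x∈p-y; x∈p⇒∣p-x∣<∣p∣; p─q⊆p
        ; p─q─r≡p─r─q; p─q─r≡p─q∪r )
open import Data.Vec using ([]; _∷_; here; there; lookup)
open import Data.Vec.Properties using (lookup∘tabulate; tabulate∘lookup; []=⇒lookup; lookup⇒[]=)
open import Data.Product using (Σ; _×_; _,_; proj₁; proj₂)
open import Data.Sum using (inj₁; inj₂)
open import Function using (_∘_; id; case_of_)
open import Relation.Nullary using (contradiction; Dec; yes; no; does; ¬?)
open import Relation.Nullary.Decidable using (_×-dec_; does-⇔)
open import Function.Bundles using (mk⇔)
open import Relation.Binary.PropositionalEquality
  using (_≡_; refl; sym; trans; cong; cong₂; subst; subst₂; module ≡-Reasoning)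
open import Algebra.Bundles using (CommutativeRing)

private
  variable
    k m : ℕ
    p q : Subset k
    M N P : RawMatroid

x∈p─q⇒x∉q : ∀ {x : Fin k} → x ∈ p ─ q → x ∉ q
x∈p─q⇒x∉q {p = inside ∷ p} {outside ∷ q} here        ()
x∈p─q⇒x∉q {p = _ ∷ p}      {inside ∷ q}  (there x∈) (there x∈q) = x∈p─q⇒x∉q x∈ x∈q
x∈p─q⇒x∉q {p = _ ∷ p}      {outside ∷ q} (there x∈) (there x∈q) = x∈p─q⇒x∉q x∈ x∈q

x∈preimage⁺ : ∀ (f : Fin k → Fin m) {x} → f x ∈ q → x ∈ preimage f q
x∈preimage⁺ {q = q} f {x} fx∈q =
  lookup⇒[]= x _ (trans (lookup∘tabulate (lookup q ∘ f) x) ([]=⇒lookup fx∈q))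

x∈preimage⁻ : ∀ (f : Fin k → Fin m) {x} → x ∈ preimage f q → f x ∈ q
x∈preimage⁻ {q = q} f {x} x∈ =
  lookup⇒[]= (f x) q (trans (sym (lookup∘tabulate (lookup q ∘ f) x)) ([]=⇒lookup x∈))

p⊆q⇒q∩p≡p : p ⊆ q → q ∩ p ≡ p
p⊆q⇒q∩p≡p p⊆q = ⊆-antisym (λ x∈ → proj₂ (x∈p∩q⁻ _ _ x∈)) (λ x∈p → x∈p∩q⁺ (p⊆q x∈p , x∈p))

∪-lub : ∀ {p q r : Subset k} → p ⊆ r → q ⊆ r → p ∪ q ⊆ r
∪-lub {p = p} {q} p⊆r q⊆r x∈ with x∈p∪q⁻ p q x∈
... | inj₁ x∈p = p⊆r x∈p
... | inj₂ x∈q = q⊆r x∈q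

p─q∪q≡p : ∀ (p q : Subset k) → q ⊆ p → (p ─ q) ∪ q ≡ p
p─q∪q≡p []            []            _   = refl
p─q∪q≡p (inside ∷ p)  (inside ∷ q)  q⊆p = cong (inside ∷_) (p─q∪q≡p p q (drop-∷-⊆ q⊆p))
p─q∪q≡p (inside ∷ p)  (outside ∷ q) q⊆p = cong (inside ∷_) (p─q∪q≡p p q (drop-∷-⊆ q⊆p))
p─q∪q≡p (outside ∷ p) (outside ∷ q) q⊆p = cong (outside ∷_) (p─q∪q≡p p q (drop-∷-⊆ q⊆p))
p─q∪q≡p (outside ∷ p) (inside ∷ q)  q⊆p = contradiction (q⊆p here) λ ()

p─[p─q]≡q : ∀ (p q : Subset k) → q ⊆ p → p ─ (p ─ q) ≡ q
p─[p─q]≡q []            []            _   = refl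
p─[p─q]≡q (inside ∷ p)  (inside ∷ q)  q⊆p = cong (inside ∷_) (p─[p─q]≡q p q (drop-∷-⊆ q⊆p))
p─[p─q]≡q (inside ∷ p)  (outside ∷ q) q⊆p = cong (outside ∷_) (p─[p─q]≡q p q (drop-∷-⊆ q⊆p))
p─[p─q]≡q (outside ∷ p) (outside ∷ q) q⊆p = cong (outside ∷_) (p─[p─q]≡q p q (drop-∷-⊆ q⊆p))
p─[p─q]≡q (outside ∷ p) (inside ∷ q)  q⊆p = contradiction (q⊆p here) λ ()

p─r≡[p─q]∪[q─r] : ∀ (p q r : Subset k) → r ⊆ q → q ⊆ p → p ─ r ≡ (p ─ q) ∪ (q ─ r)
p─r≡[p─q]∪[q─r] [] [] [] _ _ = refl
p─r≡[p─q]∪[q─r] (inside ∷ p) (inside ∷ q) (inside ∷ r) r⊆q q⊆p =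
  cong (outside ∷_) (p─r≡[p─q]∪[q─r] p q r (drop-∷-⊆ r⊆q) (drop-∷-⊆ q⊆p))
p─r≡[p─q]∪[q─r] (inside ∷ p) (inside ∷ q) (outside ∷ r) r⊆q q⊆p =
  cong (inside ∷_) (p─r≡[p─q]∪[q─r] p q r (drop-∷-⊆ r⊆q) (drop-∷-⊆ q⊆p))
p─r≡[p─q]∪[q─r] (inside ∷ p) (outside ∷ q) (outside ∷ r) r⊆q q⊆p =
  cong (inside ∷_) (p─r≡[p─q]∪[q─r] p q r (drop-∷-⊆ r⊆q) (drop-∷-⊆ q⊆p))
p─r≡[p─q]∪[q─r] (outside ∷ p) (outside ∷ q) (outside ∷ r) r⊆q q⊆p =
  cong (outside ∷_) (p─r≡[p─q]∪[q─r] p q r (drop-∷-⊆ r⊆q) (drop-∷-⊆ q⊆p))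
p─r≡[p─q]∪[q─r] (_ ∷ p) (outside ∷ q) (inside ∷ r) r⊆q q⊆p = contradiction (r⊆q here) λ ()
p─r≡[p─q]∪[q─r] (outside ∷ p) (inside ∷ q) (_ ∷ r) r⊆q q⊆p = contradiction (q⊆p here) λ ()

[p─q]∪[p─r]≡p─[q∩r] : ∀ (p q r : Subset k) → (p ─ q) ∪ (p ─ r) ≡ p ─ (q ∩ r)
[p─q]∪[p─r]≡p─[q∩r] [] [] [] = refl
[p─q]∪[p─r]≡p─[q∩r] (_ ∷ p) (inside ∷ q) (_ ∷ r) =
  cong (_ ∷_) ([p─q]∪[p─r]≡p─[q∩r] p q r)
[p─q]∪[p─r]≡p─[q∩r] (inside ∷ p) (outside ∷ q) (_ ∷ r) =
  cong (inside ∷_) ([p─q]∪[p─r]≡p─[q∩r] p q r)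
[p─q]∪[p─r]≡p─[q∩r] (outside ∷ p) (outside ∷ q) (inside ∷ r) =
  cong (outside ∷_) ([p─q]∪[p─r]≡p─[q∩r] p q r)
[p─q]∪[p─r]≡p─[q∩r] (outside ∷ p) (outside ∷ q) (outside ∷ r) =
  cong (outside ∷_) ([p─q]∪[p─r]≡p─[q∩r] p q r)

[p─q]∩[p─r]≡p─[q∪r] : ∀ (p q r : Subset k) → (p ─ q) ∩ (p ─ r) ≡ p ─ (q ∪ r)
[p─q]∩[p─r]≡p─[q∪r] [] [] [] = refl
[p─q]∩[p─r]≡p─[q∪r] (_ ∷ p) (inside ∷ q) (_ ∷ r) =
  cong (outside ∷_) ([p─q]∩[p─r]≡p─[q∪r] p q r)
[p─q]∩[p─r]≡p─[q∪r] (inside ∷ p) (outside ∷ q) (_ ∷ r) =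
  cong (_ ∷_) ([p─q]∩[p─r]≡p─[q∪r] p q r)
[p─q]∩[p─r]≡p─[q∪r] (outside ∷ p) (outside ∷ q) (inside ∷ r) =
  cong (outside ∷_) ([p─q]∩[p─r]≡p─[q∪r] p q r)
[p─q]∩[p─r]≡p─[q∪r] (outside ∷ p) (outside ∷ q) (outside ∷ r) =
  cong (outside ∷_) ([p─q]∩[p─r]≡p─[q∪r] p q r)

∣p∣≡∣q∣+∣p─q∣ : ∀ (p q : Subset k) → q ⊆ p → ∣ p ∣ ≡ ∣ q ∣ + ∣ p ─ q ∣
∣p∣≡∣q∣+∣p─q∣ []            []            _   = refl
∣p∣≡∣q∣+∣p─q∣ (inside ∷ p)  (inside ∷ q)  q⊆p = cong suc (∣p∣≡∣q∣+∣p─q∣ p q (drop-∷-⊆ q⊆p))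
∣p∣≡∣q∣+∣p─q∣ (inside ∷ p)  (outside ∷ q) q⊆p =
  trans (cong suc (∣p∣≡∣q∣+∣p─q∣ p q (drop-∷-⊆ q⊆p))) (sym (+-suc ∣ q ∣ ∣ p ─ q ∣))
∣p∣≡∣q∣+∣p─q∣ (outside ∷ p) (outside ∷ q) q⊆p = ∣p∣≡∣q∣+∣p─q∣ p q (drop-∷-⊆ q⊆p)
∣p∣≡∣q∣+∣p─q∣ (outside ∷ p) (inside ∷ q)  q⊆p = contradiction (q⊆p here) λ ()

∣p∪q∣+∣p∩q∣≡∣p∣+∣q∣ : ∀ (p q : Subset k) → ∣ p ∪ q ∣ + ∣ p ∩ q ∣ ≡ ∣ p ∣ + ∣ q ∣
∣p∪q∣+∣p∩q∣≡∣p∣+∣q∣ [] [] = refl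
∣p∪q∣+∣p∩q∣≡∣p∣+∣q∣ (inside ∷ p) (inside ∷ q) =
  cong suc (trans (+-suc ∣ p ∪ q ∣ ∣ p ∩ q ∣)
                  (trans (cong suc (∣p∪q∣+∣p∩q∣≡∣p∣+∣q∣ p q)) (sym (+-suc ∣ p ∣ ∣ q ∣))))
∣p∪q∣+∣p∩q∣≡∣p∣+∣q∣ (inside ∷ p) (outside ∷ q) = cong suc (∣p∪q∣+∣p∩q∣≡∣p∣+∣q∣ p q)
∣p∪q∣+∣p∩q∣≡∣p∣+∣q∣ (outside ∷ p) (inside ∷ q) =
  trans (cong suc (∣p∪q∣+∣p∩q∣≡∣p∣+∣q∣ p q)) (sym (+-suc ∣ p ∣ ∣ q ∣))
∣p∪q∣+∣p∩q∣≡∣p∣+∣q∣ (outside ∷ p) (outside ∷ q) = ∣p∪q∣+∣p∩q∣≡∣p∣+∣q∣ p q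

∣p─p∣≡0 : ∀ (p : Subset k) → ∣ p ─ p ∣ ≡ 0
∣p─p∣≡0 []            = refl
∣p─p∣≡0 (inside ∷ p)  = ∣p─p∣≡0 p
∣p─p∣≡0 (outside ∷ p) = ∣p─p∣≡0 p

∣p∪q∣≡∣p∣+∣q∣ : ∀ (p q : Subset k) → (∀ {x} → x ∈ p → x ∉ q) → ∣ p ∪ q ∣ ≡ ∣ p ∣ + ∣ q ∣
∣p∪q∣≡∣p∣+∣q∣ [] [] _ = refl
∣p∪q∣≡∣p∣+∣q∣ (inside ∷ p) (inside ∷ q) disj = contradiction here (disj here)
∣p∪q∣≡∣p∣+∣q∣ (inside ∷ p) (outside ∷ q) disj =
  cong suc (∣p∪q∣≡∣p∣+∣q∣ p q λ x∈p x∈q → disj (there x∈p) (there x∈q))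
∣p∪q∣≡∣p∣+∣q∣ (outside ∷ p) (inside ∷ q) disj =
  trans (cong suc (∣p∪q∣≡∣p∣+∣q∣ p q λ x∈p x∈q → disj (there x∈p) (there x∈q)))
        (sym (+-suc ∣ p ∣ ∣ q ∣))
∣p∪q∣≡∣p∣+∣q∣ (outside ∷ p) (outside ∷ q) disj =
  ∣p∪q∣≡∣p∣+∣q∣ p q λ x∈p x∈q → disj (there x∈p) (there x∈q)

injectiveOn⇒∣p∣≤∣q∣ : ∀ (p : Subset k) (q : Subset m) (f : Fin k → Fin m) →
                       (∀ {x} → x ∈ p → f x ∈ q) →
                       (∀ {x y} → x ∈ p → y ∈ p → f x ≡ f y → x ≡ y) → ∣ p ∣ ≤ ∣ q ∣
injectiveOn⇒∣p∣≤∣q∣ [] q f _ _ = z≤n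
injectiveOn⇒∣p∣≤∣q∣ (outside ∷ p) q f into inj =
  injectiveOn⇒∣p∣≤∣q∣ p q (f ∘ suc) (into ∘ there) (λ x∈ y∈ e → suc-injective (inj (there x∈) (there y∈) e))
injectiveOn⇒∣p∣≤∣q∣ (inside ∷ p) q f into inj =
  ≤-trans (s≤s (injectiveOn⇒∣p∣≤∣q∣ p (q - f zero) (f ∘ suc) into′ inj′)) (x∈p⇒∣p-x∣<∣p∣ (into here))
  where
  into′ : ∀ {x} → x ∈ p → f (suc x) ∈ q - f zero
  into′ x∈p = x∈p∧x≢y⇒x∈p-y (into (there x∈p)) (λ e → case (inj (there x∈p) here e) of λ ())
  inj′ : ∀ {x y} → x ∈ p → y ∈ p → f (suc x) ≡ f (suc y) → x ≡ y
  inj′ x∈ y∈ e = suc-injective (inj (there x∈) (there y∈) e)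

module _ {p : Subset k} {f : Fin k → Fin m} where

  x∈p∩preimage⁺ : ∀ {q x} → x ∈ p → f x ∈ q → x ∈ p ∩ preimage f q
  x∈p∩preimage⁺ x∈p fx∈q = x∈p∩q⁺ (x∈p , x∈preimage⁺ f fx∈q)

  x∈p∩preimage⁻ : ∀ q {x} → x ∈ p ∩ preimage f q → x ∈ p × f x ∈ q
  x∈p∩preimage⁻ q x∈ with x∈p , x∈f⁻q ← x∈p∩q⁻ _ _ x∈ = x∈p , x∈preimage⁻ f x∈f⁻q

  p∩preimage-mono : ∀ {q r} → q ⊆ r → p ∩ preimage f q ⊆ p ∩ preimage f r
  p∩preimage-mono {q} q⊆r x∈ with x∈p , fx∈q ← x∈p∩preimage⁻ q x∈ = x∈p∩preimage⁺ x∈p (q⊆r fx∈q)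

  p∩preimage-⊆p : ∀ q → p ∩ preimage f q ⊆ p
  p∩preimage-⊆p q x∈ = proj₁ (x∈p∩preimage⁻ q x∈)

  p∩preimage-full : ∀ q → (∀ {x} → x ∈ p → f x ∈ q) → p ∩ preimage f q ≡ p
  p∩preimage-full q into = ⊆-antisym (p∩preimage-⊆p q) (λ x∈p → x∈p∩preimage⁺ x∈p (into x∈p))

  p∩preimage-∪ : ∀ q r → p ∩ preimage f (q ∪ r) ≡ (p ∩ preimage f q) ∪ (p ∩ preimage f r)
  p∩preimage-∪ q r = ⊆-antisym to from
    where
    to : p ∩ preimage f (q ∪ r) ⊆ (p ∩ preimage f q) ∪ (p ∩ preimage f r)
    to x∈ with x∈p , fx∈ ← x∈p∩preimage⁻ (q ∪ r) x∈ | x∈p∪q⁻ q r fx∈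
    ... | inj₁ fx∈q = p⊆p∪q (p ∩ preimage f r) (x∈p∩preimage⁺ x∈p fx∈q)
    ... | inj₂ fx∈r = q⊆p∪q (p ∩ preimage f q) _ (x∈p∩preimage⁺ x∈p fx∈r)
    from : (p ∩ preimage f q) ∪ (p ∩ preimage f r) ⊆ p ∩ preimage f (q ∪ r)
    from x∈ with x∈p∪q⁻ (p ∩ preimage f q) _ x∈
    ... | inj₁ x∈q = p∩preimage-mono (p⊆p∪q {p = q} r) x∈q
    ... | inj₂ x∈r = p∩preimage-mono (q⊆p∪q q r) x∈r

  p∩preimage-∩ : ∀ q r → p ∩ preimage f (q ∩ r) ≡ (p ∩ preimage f q) ∩ (p ∩ preimage f r)
  p∩preimage-∩ q r = ⊆-antisym
    (λ x∈ → x∈p∩q⁺ (p∩preimage-mono (p∩q⊆p q r) x∈ , p∩preimage-mono (p∩q⊆q q r) x∈))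
    (λ x∈ → let x∈q , x∈r = x∈p∩q⁻ _ _ x∈ in
            x∈p∩preimage⁺ (p∩preimage-⊆p q x∈q)
              (x∈p∩q⁺ (proj₂ (x∈p∩preimage⁻ q x∈q) , proj₂ (x∈p∩preimage⁻ r x∈r))))

  p∩preimage-─ : ∀ q r → p ∩ preimage f (q ─ r) ≡ (p ∩ preimage f q) ─ (p ∩ preimage f r)
  p∩preimage-─ q r = ⊆-antisym
    (λ x∈ → let x∈p , fx∈ = x∈p∩preimage⁻ (q ─ r) x∈ in
            x∈p∧x∉q⇒x∈p─q (x∈p∩preimage⁺ x∈p (p─q⊆p q r fx∈))
                          (λ x∈r → x∈p─q⇒x∉q fx∈ (proj₂ (x∈p∩preimage⁻ r x∈r))))
    (λ x∈ → let x∈p , fx∈q = x∈p∩preimage⁻ q (p─q⊆p _ _ x∈) in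
            x∈p∩preimage⁺ x∈p
              (x∈p∧x∉q⇒x∈p─q fx∈q (λ fx∈r → x∈p─q⇒x∉q x∈ (x∈p∩preimage⁺ x∈p fx∈r))))

p∩preimage-id : ∀ {p q : Subset k} → q ⊆ p → p ∩ preimage id q ≡ q
p∩preimage-id {p = p} {q} q⊆p = trans (cong (p ∩_) (tabulate∘lookup q)) (p⊆q⇒q∩p≡p q⊆p)

p∩preimage-∘ : ∀ {p : Subset k} {p′ : Subset m} {o} {f : Fin k → Fin m} {g : Fin m → Fin o} q →
               (∀ {x} → x ∈ p → f x ∈ p′) →
               p ∩ preimage f (p′ ∩ preimage g q) ≡ p ∩ preimage (g ∘ f) q
p∩preimage-∘ {p′ = p′} q into = ⊆-antisym
  (λ x∈ → let x∈p , fx∈ = x∈p∩preimage⁻ (p′ ∩ preimage _ q) x∈ in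
          x∈p∩preimage⁺ x∈p (proj₂ (x∈p∩preimage⁻ q fx∈)))
  (λ x∈ → let x∈p , gfx∈q = x∈p∩preimage⁻ q x∈ in
          x∈p∩preimage⁺ x∈p (x∈p∩preimage⁺ (into x∈p) gfx∈q))

p∩preimage-cong : ∀ {p : Subset k} {f f′ : Fin k → Fin m} q →
                  (∀ {x} → x ∈ p → f x ≡ f′ x) → p ∩ preimage f q ≡ p ∩ preimage f′ q
p∩preimage-cong q f≗f′ = ⊆-antisym
  (λ x∈ → let x∈p , fx∈q = x∈p∩preimage⁻ q x∈ in x∈p∩preimage⁺ x∈p (subst (_∈ q) (f≗f′ x∈p) fx∈q))
  (λ x∈ → let x∈p , fx∈q = x∈p∩preimage⁻ q x∈ in x∈p∩preimage⁺ x∈p (subst (_∈ q) (sym (f≗f′ x∈p)) fx∈q))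

id-≅ : ∀ {M} {F : Subset (n M)} {ρ : Subset (n M) → ℕ} → E M ⊆ F → F ⊆ E M →
       (∀ Y → Y ⊆ F → ρ Y ≡ rank M Y) → M ≅ mkRaw (n M) F ρ
id-≅ {M} E⊆F F⊆E agree =
  id , id , mkIsIso (λ _ → E⊆F) (λ _ → F⊆E) (λ _ _ → refl) (λ _ _ → refl)
                    (λ Y Y⊆F → trans (agree Y Y⊆F) (cong (rank M) (sym (p∩preimage-id (F⊆E ∘ Y⊆F)))))

≅-refl : M ≅ M
≅-refl = id-≅ id id (λ _ _ → refl)

≅-sym : M ≅ N → N ≅ M
≅-sym {M} {N} (f , g , mkIsIso f-maps g-maps gf fg r-pres) =
  g , f , mkIsIso g-maps f-maps fg gf r-pres′
  where
  r-pres′ : ∀ Y → Y ⊆ E M → rank M Y ≡ rank N (E N ∩ preimage g Y)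
  r-pres′ Y Y⊆E = sym (trans (r-pres _ (p∩preimage-⊆p Y)) (cong (rank M) round-trip))
    where
    round-trip : E M ∩ preimage f (E N ∩ preimage g Y) ≡ Y
    round-trip = begin
      E M ∩ preimage f (E N ∩ preimage g Y) ≡⟨ p∩preimage-∘ Y (f-maps _) ⟩
      E M ∩ preimage (g ∘ f) Y               ≡⟨ p∩preimage-cong Y (gf _) ⟩
      E M ∩ preimage id Y                    ≡⟨ p∩preimage-id Y⊆E ⟩
      Y                                      ∎
      where open ≡-Reasoning

≅-trans : M ≅ N → N ≅ P → M ≅ P
≅-trans {M} {N} {P} (f , g , mkIsIso f-maps g-maps gf fg r-pres)
                    (f′ , g′ , mkIsIso f′-maps g′-maps g′f′ f′g′ r-pres′) =
  f′ ∘ f , g ∘ g′ ,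
  mkIsIso (λ x → f′-maps _ ∘ f-maps x) (λ y → g-maps _ ∘ g′-maps y)
          (λ x x∈ → trans (cong g (g′f′ _ (f-maps x x∈))) (gf x x∈))
          (λ y y∈ → trans (cong f′ (fg _ (g′-maps y y∈))) (f′g′ y y∈))
          (λ Y Y⊆E → trans (r-pres′ Y Y⊆E)
                       (trans (r-pres _ (p∩preimage-⊆p Y)) (cong (rank M) (p∩preimage-∘ Y (f-maps _)))))

preimage-size : ∀ (M≅N : M ≅ N) {Y} → Y ⊆ E N → ∣ E M ∩ preimage (proj₁ M≅N) Y ∣ ≡ ∣ Y ∣
preimage-size (f , g , mkIsIso _ g-maps gf fg _) {Y} Y⊆E = ≤-antisym
  (injectiveOn⇒∣p∣≤∣q∣ _ Y f (proj₂ ∘ x∈p∩preimage⁻ Y)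
     (λ x∈ y∈ e → trans (sym (gf _ (p∩preimage-⊆p Y x∈)))
                        (trans (cong g e) (gf _ (p∩preimage-⊆p Y y∈)))))
  (injectiveOn⇒∣p∣≤∣q∣ Y _ g
     (λ y∈ → x∈p∩preimage⁺ (g-maps _ (Y⊆E y∈)) (subst (_∈ Y) (sym (fg _ (Y⊆E y∈))) y∈))
     (λ x∈ y∈ e → trans (sym (fg _ (Y⊆E x∈))) (trans (cong f e) (fg _ (Y⊆E y∈)))))

dual-cong : M ≅ N → dual M ≅ dual N
dual-cong {M} {N} M≅N@(f , g , mkIsIso f-maps g-maps gf fg r-pres) =
  f , g , mkIsIso f-maps g-maps gf fg r-pres*
  where
  preimage-E : E M ∩ preimage f (E N) ≡ E M
  preimage-E = p∩preimage-full (E N) (f-maps _)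
  r-pres* : ∀ Y → Y ⊆ E N →
            (∣ Y ∣ + rank N (E N ─ Y)) ∸ rank N (E N)
              ≡ (∣ E M ∩ preimage f Y ∣ + rank M (E M ─ (E M ∩ preimage f Y))) ∸ rank M (E M)
  r-pres* Y Y⊆E = cong₂ _∸_
    (cong₂ _+_ (sym (preimage-size M≅N Y⊆E))
               (trans (r-pres _ (p─q⊆p _ Y))
                      (cong (rank M) (trans (p∩preimage-─ (E N) Y)
                                            (cong (_─ (E M ∩ preimage f Y)) preimage-E)))))
    (trans (r-pres _ id) (cong (rank M) preimage-E))

IsMatroid-resp-≅ : M ≅ N → IsMatroid M → IsMatroid N
IsMatroid-resp-≅ {M} {N} M≅N@(f , _ , mkIsIso _ _ _ _ r-pres) isM = record
  { r-card   = λ X X⊆E →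
      subst₂ _≤_ (sym (r-pres X X⊆E)) (preimage-size M≅N X⊆E) (r-card (pre X) (p∩preimage-⊆p X))
  ; r-mono   = λ X Y X⊆Y Y⊆E →
      subst₂ _≤_ (sym (r-pres X (Y⊆E ∘ X⊆Y))) (sym (r-pres Y Y⊆E))
        (r-mono (pre X) (pre Y) (p∩preimage-mono X⊆Y) (p∩preimage-⊆p Y))
  ; r-submod = λ X Y X⊆E Y⊆E →
      subst₂ _≤_
        (sym (cong₂ _+_ (trans (r-pres (X ∪ Y) (∪-lub X⊆E Y⊆E)) (cong (rank M) (p∩preimage-∪ X Y)))
                        (trans (r-pres (X ∩ Y) (X⊆E ∘ p∩q⊆p X Y)) (cong (rank M) (p∩preimage-∩ X Y)))))
        (sym (cong₂ _+_ (r-pres X X⊆E) (r-pres Y Y⊆E)))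
        (r-submod (pre X) (pre Y) (p∩preimage-⊆p X) (p∩preimage-⊆p Y))
  }
  where
  open IsMatroid isM
  pre : Subset (n N) → Subset (n M)
  pre X = E M ∩ preimage f X

[m∸o]∸[n∸o]≡m∸n : ∀ {m n o} → o ≤ m → o ≤ n → (m ∸ o) ∸ (n ∸ o) ≡ m ∸ n
[m∸o]∸[n∸o]≡m∸n {m} {n} {o} o≤m o≤n = begin
  (m ∸ o) ∸ (n ∸ o)             ≡⟨ [m+n]∸[m+o]≡n∸o o (m ∸ o) (n ∸ o) ⟨
  (o + (m ∸ o)) ∸ (o + (n ∸ o)) ≡⟨ cong₂ _∸_ (m+[n∸m]≡n o≤m) (m+[n∸m]≡n o≤n) ⟩
  m ∸ n                         ∎
  where open ≡-Reasoning

[m∸o]+[n∸o]≤[p∸o]+[q∸o] : ∀ {m n p q o} → o ≤ m → o ≤ n → o ≤ p → o ≤ q →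
                          m + n ≤ p + q → (m ∸ o) + (n ∸ o) ≤ (p ∸ o) + (q ∸ o)
[m∸o]+[n∸o]≤[p∸o]+[q∸o] {m} {n} {p} {q} {o} o≤m o≤n o≤p o≤q m+n≤p+q =
  +-cancelʳ-≤ (o + o) _ _ (begin
    (m ∸ o) + (n ∸ o) + (o + o)   ≡⟨ interchange (m ∸ o) (n ∸ o) o o ⟩
    (m ∸ o + o) + (n ∸ o + o)     ≡⟨ cong₂ _+_ (m∸n+n≡m o≤m) (m∸n+n≡m o≤n) ⟩
    m + n                         ≤⟨ m+n≤p+q ⟩
    p + q                         ≡⟨ cong₂ _+_ (m∸n+n≡m o≤p) (m∸n+n≡m o≤q) ⟨
    (p ∸ o + o) + (q ∸ o + o)     ≡⟨ interchange (p ∸ o) (q ∸ o) o o ⟨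
    (p ∸ o) + (q ∸ o) + (o + o)   ∎)
  where
  open ℕ.≤-Reasoning
  open import Algebra.Properties.CommutativeSemigroup ℕ.+-commutativeSemigroup using (interchange)

module _ {M : RawMatroid} (isM : IsMatroid M) where
  open IsMatroid isM
  open import Algebra.Properties.CommutativeSemigroup ℕ.+-commutativeSemigroup
    using (interchange; x∙yz≈xz∙y; xy∙z≈y∙xz)

  private
    S = E M
    r = rank M
    -- rank (dual M) X = ρ X ∸ r S, and r[S]≤ρ below shows that this subtraction never truncates.
    ρ : Subset (n M) → ℕ
    ρ X = ∣ X ∣ + r (S ─ X)

  r[∪]≤r+∣∣ : ∀ X Y → X ⊆ S → Y ⊆ S → r (X ∪ Y) ≤ r X + ∣ Y ∣
  r[∪]≤r+∣∣ X Y X⊆S Y⊆S = begin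
    r (X ∪ Y)               ≤⟨ m≤m+n (r (X ∪ Y)) (r (X ∩ Y)) ⟩
    r (X ∪ Y) + r (X ∩ Y)   ≤⟨ r-submod X Y X⊆S Y⊆S ⟩
    r X + r Y               ≤⟨ +-monoʳ-≤ (r X) (r-card Y Y⊆S) ⟩
    r X + ∣ Y ∣             ∎
    where open ℕ.≤-Reasoning

  r[S]≤ρ : ∀ X → X ⊆ S → r S ≤ ρ X
  r[S]≤ρ X X⊆S = begin
    r S                   ≡⟨ cong r (p─q∪q≡p S X X⊆S) ⟨
    r ((S ─ X) ∪ X)       ≤⟨ r[∪]≤r+∣∣ (S ─ X) X (p─q⊆p S X) X⊆S ⟩
    r (S ─ X) + ∣ X ∣     ≡⟨ ℕ.+-comm (r (S ─ X)) (∣ X ∣) ⟩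
    ρ X                   ∎
    where open ℕ.≤-Reasoning

  ρ-mono : ∀ X Y → X ⊆ Y → Y ⊆ S → ρ X ≤ ρ Y
  ρ-mono X Y X⊆Y Y⊆S = begin
    ∣ X ∣ + r (S ─ X)
      ≡⟨ cong (λ Z → ∣ X ∣ + r Z) (p─r≡[p─q]∪[q─r] S Y X X⊆Y Y⊆S) ⟩
    ∣ X ∣ + r ((S ─ Y) ∪ (Y ─ X))
      ≤⟨ +-monoʳ-≤ (∣ X ∣) (r[∪]≤r+∣∣ (S ─ Y) (Y ─ X) (p─q⊆p S Y) (Y⊆S ∘ p─q⊆p Y X)) ⟩
    ∣ X ∣ + (r (S ─ Y) + ∣ Y ─ X ∣)
      ≡⟨ x∙yz≈xz∙y (∣ X ∣) (r (S ─ Y)) (∣ Y ─ X ∣) ⟩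
    (∣ X ∣ + ∣ Y ─ X ∣) + r (S ─ Y)
      ≡⟨ cong (_+ r (S ─ Y)) (∣p∣≡∣q∣+∣p─q∣ Y X X⊆Y) ⟨
    ∣ Y ∣ + r (S ─ Y) ∎
    where open ℕ.≤-Reasoning

  ρ-submod : ∀ X Y → X ⊆ S → Y ⊆ S → ρ (X ∪ Y) + ρ (X ∩ Y) ≤ ρ X + ρ Y
  ρ-submod X Y X⊆S Y⊆S = begin
    ρ (X ∪ Y) + ρ (X ∩ Y)
      ≡⟨ interchange (∣ X ∪ Y ∣) (r (S ─ (X ∪ Y))) (∣ X ∩ Y ∣) (r (S ─ (X ∩ Y))) ⟩
    (∣ X ∪ Y ∣ + ∣ X ∩ Y ∣) + (r (S ─ (X ∪ Y)) + r (S ─ (X ∩ Y)))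
      ≡⟨ cong₂ _+_ (∣p∪q∣+∣p∩q∣≡∣p∣+∣q∣ X Y) (ℕ.+-comm (r (S ─ (X ∪ Y))) (r (S ─ (X ∩ Y)))) ⟩
    (∣ X ∣ + ∣ Y ∣) + (r (S ─ (X ∩ Y)) + r (S ─ (X ∪ Y)))
      ≡⟨ cong (λ t → (∣ X ∣ + ∣ Y ∣) + t)
              (cong₂ (λ U V → r U + r V) ([p─q]∪[p─r]≡p─[q∩r] S X Y) ([p─q]∩[p─r]≡p─[q∪r] S X Y)) ⟨
    (∣ X ∣ + ∣ Y ∣) + (r ((S ─ X) ∪ (S ─ Y)) + r ((S ─ X) ∩ (S ─ Y)))
      ≤⟨ +-monoʳ-≤ (∣ X ∣ + ∣ Y ∣) (r-submod (S ─ X) (S ─ Y) (p─q⊆p S X) (p─q⊆p S Y)) ⟩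
    (∣ X ∣ + ∣ Y ∣) + (r (S ─ X) + r (S ─ Y))
      ≡⟨ interchange (∣ X ∣) (∣ Y ∣) (r (S ─ X)) (r (S ─ Y)) ⟩
    ρ X + ρ Y ∎
    where open ℕ.≤-Reasoning

  dual-isMatroid : IsMatroid (dual M)
  dual-isMatroid = record
    { r-card   = λ X X⊆S → m≤n+o⇒m∸n≤o (ρ X) (r S)
                   (subst (ρ X ≤_) (ℕ.+-comm (∣ X ∣) (r S))
                          (+-monoʳ-≤ (∣ X ∣) (r-mono (S ─ X) S (p─q⊆p S X) id)))
    ; r-mono   = λ X Y X⊆Y Y⊆S → ∸-monoˡ-≤ (r S) (ρ-mono X Y X⊆Y Y⊆S)
    ; r-submod = λ X Y X⊆S Y⊆S → [m∸o]+[n∸o]≤[p∸o]+[q∸o]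
                   (r[S]≤ρ (X ∪ Y) (∪-lub X⊆S Y⊆S)) (r[S]≤ρ (X ∩ Y) (X⊆S ∘ p∩q⊆p X Y))
                   (r[S]≤ρ X X⊆S) (r[S]≤ρ Y Y⊆S) (ρ-submod X Y X⊆S Y⊆S)
    }

  ≅-dual-dual : M ≅ dual (dual M)
  ≅-dual-dual = id-≅ id id agree
    where
    agree : ∀ Y → Y ⊆ S → rank (dual (dual M)) Y ≡ r Y
    agree Y Y⊆S = begin
      (∣ Y ∣ + ((∣ S ─ Y ∣ + r (S ─ (S ─ Y))) ∸ r S)) ∸ ((∣ S ∣ + r (S ─ S)) ∸ r S)
        ≡⟨ cong₂ (λ U c → (∣ Y ∣ + ((∣ S ─ Y ∣ + r U) ∸ r S)) ∸ (c ∸ r S)) (p─[p─q]≡q S Y Y⊆S) ∣S∣+r∅ ⟩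
      (∣ Y ∣ + ((∣ S ─ Y ∣ + r Y) ∸ r S)) ∸ ((∣ Y ∣ + ∣ S ─ Y ∣) ∸ r S)
        ≡⟨ cong (_∸ ((∣ Y ∣ + ∣ S ─ Y ∣) ∸ r S)) (+-∸-assoc (∣ Y ∣) r[S]≤ρ[S─Y]) ⟨
      ((∣ Y ∣ + (∣ S ─ Y ∣ + r Y)) ∸ r S) ∸ ((∣ Y ∣ + ∣ S ─ Y ∣) ∸ r S)
        ≡⟨ [m∸o]∸[n∸o]≡m∸n (≤-trans r[S]≤ρ[S─Y] (m≤n+m _ (∣ Y ∣))) (subst (r S ≤_) ∣S∣+r∅ (r[S]≤ρ S id)) ⟩
      (∣ Y ∣ + (∣ S ─ Y ∣ + r Y)) ∸ (∣ Y ∣ + ∣ S ─ Y ∣)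
        ≡⟨ cong (_∸ (∣ Y ∣ + ∣ S ─ Y ∣)) (ℕ.+-assoc (∣ Y ∣) (∣ S ─ Y ∣) (r Y)) ⟨
      ((∣ Y ∣ + ∣ S ─ Y ∣) + r Y) ∸ (∣ Y ∣ + ∣ S ─ Y ∣)
        ≡⟨ m+n∸m≡n (∣ Y ∣ + ∣ S ─ Y ∣) (r Y) ⟩
      r Y ∎
      where
      open ≡-Reasoning
      r∅ : r (S ─ S) ≡ 0
      r∅ = n≤0⇒n≡0 (subst (r (S ─ S) ≤_) (∣p─p∣≡0 S) (r-card (S ─ S) (p─q⊆p S S)))
      ∣S∣+r∅ : ∣ S ∣ + r (S ─ S) ≡ ∣ Y ∣ + ∣ S ─ Y ∣
      ∣S∣+r∅ = trans (cong (∣ S ∣ +_) r∅) (trans (ℕ.+-identityʳ (∣ S ∣)) (∣p∣≡∣q∣+∣p─q∣ S Y Y⊆S))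
      r[S]≤ρ[S─Y] : r S ≤ ∣ S ─ Y ∣ + r Y
      r[S]≤ρ[S─Y] = subst (λ U → r S ≤ ∣ S ─ Y ∣ + r U) (p─[p─q]≡q S Y Y⊆S) (r[S]≤ρ (S ─ Y) (p─q⊆p S Y))

  restrict-dual≅dual-contract : ∀ A → A ⊆ S → restrict (dual M) (S ─ A) ≅ dual (contract M A)
  restrict-dual≅dual-contract A A⊆S = id-≅ id id agree
    where
    agree : ∀ Y → Y ⊆ S ─ A → rank (dual (contract M A)) Y ≡ rank (dual M) Y
    agree Y Y⊆S─A = begin
      (∣ Y ∣ + (r (((S ─ A) ─ Y) ∪ A) ∸ r A)) ∸ (r ((S ─ A) ∪ A) ∸ r A)
        ≡⟨ cong₂ (λ U V → (∣ Y ∣ + (r U ∸ r A)) ∸ (r V ∸ r A)) [S─A─Y]∪A≡S─Y (p─q∪q≡p S A A⊆S) ⟩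
      (∣ Y ∣ + (r (S ─ Y) ∸ r A)) ∸ (r S ∸ r A)
        ≡⟨ cong (_∸ (r S ∸ r A)) (+-∸-assoc (∣ Y ∣) r[A]≤r[S─Y]) ⟨
      ((∣ Y ∣ + r (S ─ Y)) ∸ r A) ∸ (r S ∸ r A)
        ≡⟨ [m∸o]∸[n∸o]≡m∸n (≤-trans r[A]≤r[S─Y] (m≤n+m _ (∣ Y ∣))) (r-mono A S A⊆S id) ⟩
      (∣ Y ∣ + r (S ─ Y)) ∸ r S ∎
      where
      open ≡-Reasoning
      A⊆S─Y : A ⊆ S ─ Y
      A⊆S─Y x∈A = x∈p∧x∉q⇒x∈p─q (A⊆S x∈A) (λ x∈Y → x∈p─q⇒x∉q (Y⊆S─A x∈Y) x∈A)
      r[A]≤r[S─Y] : r A ≤ r (S ─ Y)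
      r[A]≤r[S─Y] = r-mono A (S ─ Y) A⊆S─Y (p─q⊆p S Y)
      [S─A─Y]∪A≡S─Y : ((S ─ A) ─ Y) ∪ A ≡ S ─ Y
      [S─A─Y]∪A≡S─Y = trans (cong (_∪ A) (p─q─r≡p─r─q S A Y)) (p─q∪q≡p (S ─ Y) A A⊆S─Y)

  contract-dual≅dual-restrict : ∀ A → A ⊆ S → contract (dual M) (S ─ A) ≅ dual (restrict M A)
  contract-dual≅dual-restrict A A⊆S =
    id-≅ (subst (_⊆ A) (sym S─[S─A]≡A) id) (subst (A ⊆_) (sym S─[S─A]≡A) id) agree
    where
    S─[S─A]≡A : S ─ (S ─ A) ≡ A
    S─[S─A]≡A = p─[p─q]≡q S A A⊆S
    agree : ∀ Y → Y ⊆ A → rank (dual (restrict M A)) Y ≡ rank (contract (dual M) (S ─ A)) Y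
    agree Y Y⊆A = sym (begin
      ((∣ Y ∪ (S ─ A) ∣ + r (S ─ (Y ∪ (S ─ A)))) ∸ r S) ∸ ((∣ S ─ A ∣ + r (S ─ (S ─ A))) ∸ r S)
        ≡⟨ cong₂ (λ u V → (u ∸ r S) ∸ ((∣ S ─ A ∣ + r V) ∸ r S)) ρ[Y∪[S─A]] S─[S─A]≡A ⟩
      ((∣ Y ∣ + ∣ S ─ A ∣ + r (A ─ Y)) ∸ r S) ∸ ((∣ S ─ A ∣ + r A) ∸ r S)
        ≡⟨ [m∸o]∸[n∸o]≡m∸n (subst (r S ≤_) ρ[Y∪[S─A]] (r[S]≤ρ _ (∪-lub (A⊆S ∘ Y⊆A) (p─q⊆p S A))))
                           (subst (λ V → r S ≤ ∣ S ─ A ∣ + r V) S─[S─A]≡A (r[S]≤ρ (S ─ A) (p─q⊆p S A))) ⟩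
      (∣ Y ∣ + ∣ S ─ A ∣ + r (A ─ Y)) ∸ (∣ S ─ A ∣ + r A)
        ≡⟨ cong (_∸ (∣ S ─ A ∣ + r A)) (xy∙z≈y∙xz (∣ Y ∣) (∣ S ─ A ∣) (r (A ─ Y))) ⟩
      (∣ S ─ A ∣ + (∣ Y ∣ + r (A ─ Y))) ∸ (∣ S ─ A ∣ + r A)
        ≡⟨ [m+n]∸[m+o]≡n∸o (∣ S ─ A ∣) (∣ Y ∣ + r (A ─ Y)) (r A) ⟩
      (∣ Y ∣ + r (A ─ Y)) ∸ r A ∎)
      where
      open ≡-Reasoning
      S─[Y∪[S─A]]≡A─Y : S ─ (Y ∪ (S ─ A)) ≡ A ─ Y
      S─[Y∪[S─A]]≡A─Y = begin
        S ─ (Y ∪ (S ─ A))   ≡⟨ p─q─r≡p─q∪r S Y (S ─ A) ⟨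
        S ─ Y ─ (S ─ A)     ≡⟨ p─q─r≡p─r─q S Y (S ─ A) ⟩
        S ─ (S ─ A) ─ Y     ≡⟨ cong (_─ Y) S─[S─A]≡A ⟩
        A ─ Y               ∎
      ρ[Y∪[S─A]] : ∣ Y ∪ (S ─ A) ∣ + r (S ─ (Y ∪ (S ─ A))) ≡ ∣ Y ∣ + ∣ S ─ A ∣ + r (A ─ Y)
      ρ[Y∪[S─A]] = cong₂ _+_ (∣p∪q∣≡∣p∣+∣q∣ Y (S ─ A) (λ x∈Y x∈S─A → x∈p─q⇒x∉q x∈S─A (Y⊆A x∈Y)))
                             (cong r S─[Y∪[S─A]]≡A─Y)

filter-map : ∀ {A B : Set} {P : B → Set} (P? : ∀ b → Dec (P b)) (h : A → B) (l : List A) →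
             filter P? (map h l) ≡ map h (filter (P? ∘ h) l)
filter-map P? h []      = refl
filter-map P? h (a ∷ l) with does (P? (h a))
... | true  = cong (h a ∷_) (filter-map P? h l)
... | false = filter-map P? h l

subsetsOf : Subset k → List (Subset k)
subsetsOf {k} E = filter (_⊆? E) (subsets k)

subsetsOf-∷ : ∀ s (E : Subset k) →
              subsetsOf (s ∷ E) ≡ map (inside ∷_) (filter ((_⊆? s ∷ E) ∘ (inside ∷_)) (subsets k))
                                    ++ map (outside ∷_) (subsetsOf E)
subsetsOf-∷ {k} s E = begin
  filter (_⊆? s ∷ E) (map (inside ∷_) S ++ map (outside ∷_) S)
    ≡⟨ filter-++ (_⊆? s ∷ E) (map (inside ∷_) S) (map (outside ∷_) S) ⟩
  filter (_⊆? s ∷ E) (map (inside ∷_) S) ++ filter (_⊆? s ∷ E) (map (outside ∷_) S)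
    ≡⟨ cong₂ _++_ (filter-map (_⊆? s ∷ E) (inside ∷_) S) (filter-map (_⊆? s ∷ E) (outside ∷_) S) ⟩
  map (inside ∷_) (filter ((_⊆? s ∷ E) ∘ (inside ∷_)) S)
    ++ map (outside ∷_) (filter ((_⊆? s ∷ E) ∘ (outside ∷_)) S)
    ≡⟨ cong (λ U → map (inside ∷_) (filter ((_⊆? s ∷ E) ∘ (inside ∷_)) S) ++ map (outside ∷_) U)
            (filter-≐ _ (_⊆? E) (drop-∷-⊆ , out⊆) S) ⟩
  map (inside ∷_) (filter ((_⊆? s ∷ E) ∘ (inside ∷_)) S) ++ map (outside ∷_) (subsetsOf E) ∎
  where
  open ≡-Reasoning
  S = subsets k

subsetsOf-inside : ∀ (E : Subset k) →
                   subsetsOf (inside ∷ E) ≡ map (inside ∷_) (subsetsOf E) ++ map (outside ∷_) (subsetsOf E)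
subsetsOf-inside {k} E =
  trans (subsetsOf-∷ inside E)
        (cong (λ U → map (inside ∷_) U ++ map (outside ∷_) (subsetsOf E))
              (filter-≐ _ (_⊆? E) (drop-∷-⊆ , in⊆in) (subsets k)))

subsetsOf-outside : ∀ (E : Subset k) → subsetsOf (outside ∷ E) ≡ map (outside ∷_) (subsetsOf E)
subsetsOf-outside {k} E =
  trans (subsetsOf-∷ outside E)
        (cong (λ U → map (inside ∷_) U ++ map (outside ∷_) (subsetsOf E))
              (filter-none _ (universal (λ _ ⊆E → case ⊆E here of λ ()) (subsets k))))

module Sums {c ℓ : Level} (K : CommutativeRing c ℓ) where
  open CommutativeRing K
    using ( Carrier; _≈_; 0#; 1#; setoid; +-cong; +-congˡ; +-congʳ; *-congˡ; +-assoc; +-comm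
          ; +-identityˡ; +-identityʳ; *-identityʳ; zeroˡ; zeroʳ; distribˡ; +-commutativeSemigroup )
    renaming (_+_ to _+K_; _*_ to _*K_; refl to ≈-refl; sym to ≈-sym; trans to ≈-trans; reflexive to ≈-reflexive)
  open Algebra K using (fromℕ; sumK)
  open import Algebra.Properties.CommutativeSemigroup +-commutativeSemigroup using (interchange)
  open import Relation.Binary.Reasoning.Setoid setoid

  ∑ : ∀ {A : Set} → List A → (A → Carrier) → Carrier
  ∑ l g = sumK (map g l)

  ∑-++ : ∀ {A : Set} (l l′ : List A) g → ∑ (l ++ l′) g ≈ ∑ l g +K ∑ l′ g
  ∑-++ []      l′ g = ≈-sym (+-identityˡ _)
  ∑-++ (a ∷ l) l′ g = begin
    g a +K ∑ (l ++ l′) g         ≈⟨ +-congˡ (∑-++ l l′ g) ⟩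
    g a +K (∑ l g +K ∑ l′ g)     ≈⟨ +-assoc _ _ _ ⟨
    (g a +K ∑ l g) +K ∑ l′ g     ∎

  ∑-map : ∀ {A B : Set} (h : A → B) (l : List A) g → ∑ (map h l) g ≡ ∑ l (g ∘ h)
  ∑-map h l g = cong sumK (sym (map-∘ l))

  ∑-cong : ∀ {A : Set} {g g′ : A → Carrier} {l} → All (λ a → g a ≈ g′ a) l → ∑ l g ≈ ∑ l g′
  ∑-cong []         = ≈-refl
  ∑-cong (ga≈ ∷ gs) = +-cong ga≈ (∑-cong gs)

  ∑-+ : ∀ {A : Set} (l : List A) g g′ → ∑ l (λ a → g a +K g′ a) ≈ ∑ l g +K ∑ l g′
  ∑-+ []      g g′ = ≈-sym (+-identityˡ 0#)
  ∑-+ (a ∷ l) g g′ = begin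
    (g a +K g′ a) +K ∑ l (λ a → g a +K g′ a) ≈⟨ +-congˡ (∑-+ l g g′) ⟩
    (g a +K g′ a) +K (∑ l g +K ∑ l g′)       ≈⟨ interchange _ _ _ _ ⟩
    (g a +K ∑ l g) +K (g′ a +K ∑ l g′)       ∎

  ∑-subsetsOf-inside : ∀ (E : Subset k) g →
    ∑ (subsetsOf (inside ∷ E)) g ≈ ∑ (subsetsOf E) (g ∘ (inside ∷_)) +K ∑ (subsetsOf E) (g ∘ (outside ∷_))
  ∑-subsetsOf-inside E g = begin
    ∑ (subsetsOf (inside ∷ E)) g
      ≡⟨ cong (λ l → ∑ l g) (subsetsOf-inside E) ⟩
    ∑ (map (inside ∷_) (subsetsOf E) ++ map (outside ∷_) (subsetsOf E)) g
      ≈⟨ ∑-++ (map (inside ∷_) (subsetsOf E)) _ g ⟩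
    ∑ (map (inside ∷_) (subsetsOf E)) g +K ∑ (map (outside ∷_) (subsetsOf E)) g
      ≡⟨ cong₂ _+K_ (∑-map (inside ∷_) (subsetsOf E) g) (∑-map (outside ∷_) (subsetsOf E) g) ⟩
    ∑ (subsetsOf E) (g ∘ (inside ∷_)) +K ∑ (subsetsOf E) (g ∘ (outside ∷_)) ∎

  ∑-subsetsOf-outside : ∀ (E : Subset k) g →
    ∑ (subsetsOf (outside ∷ E)) g ≡ ∑ (subsetsOf E) (g ∘ (outside ∷_))
  ∑-subsetsOf-outside E g =
    trans (cong (λ l → ∑ l g) (subsetsOf-outside E)) (∑-map (outside ∷_) (subsetsOf E) g)

  ∑-complement : ∀ (E : Subset k) f → ∑ (subsetsOf E) (λ A → f (E ─ A)) ≈ ∑ (subsetsOf E) f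
  ∑-complement []            f = ≈-refl
  ∑-complement (inside ∷ E)  f = begin
    ∑ (subsetsOf (inside ∷ E)) (λ A → f ((inside ∷ E) ─ A))
      ≈⟨ ∑-subsetsOf-inside E _ ⟩
    ∑ (subsetsOf E) (λ A → f (outside ∷ (E ─ A))) +K ∑ (subsetsOf E) (λ A → f (inside ∷ (E ─ A)))
      ≈⟨ +-cong (∑-complement E (f ∘ (outside ∷_))) (∑-complement E (f ∘ (inside ∷_))) ⟩
    ∑ (subsetsOf E) (f ∘ (outside ∷_)) +K ∑ (subsetsOf E) (f ∘ (inside ∷_))
      ≈⟨ +-comm _ _ ⟩
    ∑ (subsetsOf E) (f ∘ (inside ∷_)) +K ∑ (subsetsOf E) (f ∘ (outside ∷_))
      ≈⟨ ∑-subsetsOf-inside E f ⟨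
    ∑ (subsetsOf (inside ∷ E)) f ∎
  ∑-complement (outside ∷ E) f = begin
    ∑ (subsetsOf (outside ∷ E)) (λ A → f ((outside ∷ E) ─ A))
      ≡⟨ ∑-subsetsOf-outside E _ ⟩
    ∑ (subsetsOf E) (λ A → f (outside ∷ (E ─ A)))
      ≈⟨ ∑-complement E (f ∘ (outside ∷_)) ⟩
    ∑ (subsetsOf E) (f ∘ (outside ∷_))
      ≡⟨ ∑-subsetsOf-outside E f ⟨
    ∑ (subsetsOf (outside ∷ E)) f ∎

  ∑-cong′ : ∀ {A : Set} {g g′ : A → Carrier} l → (∀ a → g a ≈ g′ a) → ∑ l g ≈ ∑ l g′
  ∑-cong′ l g≈g′ = ∑-cong (universal g≈g′ l)

  module _ {A : Set} {R : A → A → Set} (R? : ∀ a b → Dec (R a b)) (isEquiv : IsEquivalence R)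
           {P : A → Set} where
    open IsEquivalence isEquiv renaming (refl to R-refl; sym to R-sym; trans to R-trans)

    count : List A → A → ℕ
    count l a = length (filter (λ b → R? b a) l)

    RespectsOn : (A → Carrier) → Set ℓ
    RespectsOn F = ∀ {a b} → P a → P b → R a b → F a ≈ F b

    onClass offClass : A → (A → Carrier) → A → Carrier
    onClass  x F a = if does (R? x a) then F a else 0#
    offClass x F a = if does (R? x a) then 0# else F a

    ∑-onClass : ∀ {x} F → P x → RespectsOn F → ∀ l → All P l →
                F x *K fromℕ (count l x) ≈ ∑ l (onClass x F)
    ∑-onClass F Px resp []      []        = zeroʳ _
    ∑-onClass {x} F Px resp (y ∷ l) (Py ∷ Pl) with R? y x | R? x y
    ... | yes _   | yes Rxy = begin
      F x *K (1# +K fromℕ (count l x))        ≈⟨ distribˡ _ _ _ ⟩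
      F x *K 1# +K F x *K fromℕ (count l x)   ≈⟨ +-cong (≈-trans (*-identityʳ _) (resp Px Py Rxy))
                                                        (∑-onClass F Px resp l Pl) ⟩
      F y +K ∑ l (onClass x F)                ∎
    ... | no _    | no _    = ≈-trans (∑-onClass F Px resp l Pl) (≈-sym (+-identityˡ _))
    ... | yes Ryx | no ¬Rxy = contradiction (R-sym Ryx) ¬Rxy
    ... | no ¬Ryx | yes Rxy = contradiction (R-sym Rxy) ¬Ryx

    offClass-respects : ∀ x F → RespectsOn F → RespectsOn (offClass x F)
    offClass-respects x F resp {a} {b} Pa Pb Rab with R? x a | R? x b
    ... | yes _   | yes _   = ≈-refl
    ... | no _    | no _    = resp Pa Pb Rab
    ... | yes Rxa | no ¬Rxb = contradiction (R-trans Rxa Rab) ¬Rxb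
    ... | no ¬Rxa | yes Rxb = contradiction (R-trans Rxb (R-sym Rab)) ¬Rxa

    ∑-filter-¬ : ∀ x l G → ∑ (filter (¬? ∘ R? x) l) G ≈ ∑ l (offClass x G)
    ∑-filter-¬ x []      G = ≈-refl
    ∑-filter-¬ x (a ∷ l) G with R? x a
    ... | yes _ = ≈-trans (∑-filter-¬ x l G) (≈-sym (+-identityˡ _))
    ... | no _  = +-congˡ (∑-filter-¬ x l G)

    -- Split off the class of the head x: its terms give F x times its size (∑-onClass), and the
    -- other classes are handled by induction on the tail with F replaced by offClass x F.
    ∑-deduplicate : ∀ l F → All P l → RespectsOn F →
                    ∑ (deduplicate R? l) (λ a → F a *K fromℕ (count l a)) ≈ ∑ l F
    ∑-deduplicate []      F []        resp = ≈-refl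
    ∑-deduplicate (x ∷ l) F (Px ∷ Pl) resp = begin
      F x *K fromℕ (count (x ∷ l) x)
        +K ∑ (filter (¬? ∘ R? x) (deduplicate R? l)) (λ a → F a *K fromℕ (count (x ∷ l) a))
        ≈⟨ +-cong (*-congˡ (≈-reflexive (cong fromℕ count-self)))
                  (≈-trans (∑-filter-¬ x (deduplicate R? l) _) (∑-cong′ (deduplicate R? l) off-count)) ⟩
      F x *K (1# +K fromℕ (count l x)) +K ∑ (deduplicate R? l) (λ a → offClass x F a *K fromℕ (count l a))
        ≈⟨ +-cong (distribˡ _ _ _) (∑-deduplicate l (offClass x F) Pl (offClass-respects x F resp)) ⟩
      (F x *K 1# +K F x *K fromℕ (count l x)) +K ∑ l (offClass x F)
        ≈⟨ +-congʳ (+-cong (*-identityʳ _) (∑-onClass F Px resp l Pl)) ⟩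
      (F x +K ∑ l (onClass x F)) +K ∑ l (offClass x F)
        ≈⟨ +-assoc _ _ _ ⟩
      F x +K (∑ l (onClass x F) +K ∑ l (offClass x F))
        ≈⟨ +-congˡ (≈-trans (≈-sym (∑-+ l _ _)) (∑-cong′ l on+off)) ⟩
      F x +K ∑ l F ∎
      where
      count-self : count (x ∷ l) x ≡ suc (count l x)
      count-self with R? x x
      ... | yes _   = refl
      ... | no ¬Rxx = contradiction R-refl ¬Rxx
      off-count : ∀ a → offClass x (λ b → F b *K fromℕ (count (x ∷ l) b)) a
                          ≈ offClass x F a *K fromℕ (count l a)
      off-count a with R? x a
      ... | yes _ = ≈-sym (zeroˡ _)
      ... | no _  = ≈-refl
      on+off : ∀ a → onClass x F a +K offClass x F a ≈ F a
      on+off a with R? x a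
      ... | yes _ = +-identityʳ _
      ... | no _  = +-identityˡ _

empty-isMatroid : IsMatroid emptyMatroid
empty-isMatroid = record { r-card = λ _ _ → z≤n ; r-mono = λ _ _ _ _ → z≤n ; r-submod = λ _ _ _ _ → z≤n }

dual-empty≅empty : dual emptyMatroid ≅ emptyMatroid
dual-empty≅empty = id-≅ id id (λ { [] _ → refl })

module _ {𝓜 : RawMatroid → Set} (mc : MinorClosedClass 𝓜) where
  open MinorClosedClass mc

  DualClass-isMatroid : DualClass 𝓜 M → IsMatroid M
  DualClass-isMatroid (N , N∈𝓜 , M≅N*) = IsMatroid-resp-≅ (≅-sym M≅N*) (dual-isMatroid (matroids N N∈𝓜))

  DualClass-dual : DualClass 𝓜 M → 𝓜 (dual M)
  DualClass-dual {M} (N , N∈𝓜 , M≅N*) =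
    iso-closed N (dual M) N∈𝓜 (≅-trans (≅-dual-dual (matroids N N∈𝓜)) (≅-sym (dual-cong M≅N*)))

dual-DualClass : ∀ {𝓜 : RawMatroid → Set} → 𝓜 M → DualClass 𝓜 (dual M)
dual-DualClass {M} M∈𝓜 = M , M∈𝓜 , ≅-refl

module _ {c ℓ : Level} (K : CommutativeRing c ℓ) where
  open CommutativeRing K
    using (_≈_; 0#; 1#; setoid; *-cong; *-comm)
    renaming (_*_ to _*K_; refl to ≈-refl; sym to ≈-sym; trans to ≈-trans; reflexive to ≈-reflexive)
  open Algebra K
  open Sums K
  open import Relation.Binary.Reasoning.Setoid setoid

  D : Coef → Coef
  D x M = x (dual M)

  -- The product sums over one representative A per class of (Q|A, Q/A) weighted by its section
  -- coefficient, which is the number of subsets A′ in that class.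
  ·-coefficient : ∀ Q {a b : Coef} →
    (∀ {A A′} → A ⊆ E Q → restrict Q A ≅ restrict Q A′ → a (restrict Q A) ≈ a (restrict Q A′)) →
    (∀ {A A′} → A ⊆ E Q → contract Q A ≅ contract Q A′ → b (contract Q A) ≈ b (contract Q A′)) →
    (a · b) Q ≈ ∑ (groundSubsets Q) (λ A → a (restrict Q A) *K b (contract Q A))
  ·-coefficient Q a-inv b-inv =
    ∑-deduplicate R? isEquivalence (groundSubsets Q) _ (all-filter (_⊆? E Q) (subsets (n Q)))
      (λ A⊆E _ (res≅ , con≅) → *-cong (a-inv A⊆E res≅) (b-inv A⊆E con≅))
    where
    R? = λ A A′ → (restrict Q A ≅? restrict Q A′) ×-dec (contract Q A ≅? contract Q A′)
    isEquivalence : IsEquivalence (λ A A′ → (restrict Q A ≅ restrict Q A′) × (contract Q A ≅ contract Q A′))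
    isEquivalence = record
      { refl  = ≅-refl , ≅-refl
      ; sym   = λ (res≅ , con≅) → ≅-sym res≅ , ≅-sym con≅
      ; trans = λ (res≅ , con≅) (res≅′ , con≅′) → ≅-trans res≅ res≅′ , ≅-trans con≅ con≅′
      }

  basis-resp-≅ : ∀ {N N′} M → N ≅ N′ → basis N M ≡ basis N′ M
  basis-resp-≅ M N≅N′ = cong (if_then 1# else 0#) (does-⇔ (mk⇔ to from) (M ≅? _) (M ≅? _))
    where
    to   = λ M≅N → ≅-trans M≅N N≅N′
    from = λ M≅N′ → ≅-trans M≅N′ (≅-sym N≅N′)

  basis-dual : IsMatroid M → IsMatroid N → basis N (dual M) ≡ basis (dual N) M
  basis-dual {M} {N} isM isN = cong (if_then 1# else 0#) (does-⇔ (mk⇔ to from) (dual M ≅? N) (M ≅? dual N))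
    where
    to : dual M ≅ N → M ≅ dual N
    to M*≅N = ≅-trans (≅-dual-dual isM) (dual-cong M*≅N)
    from : M ≅ dual N → dual M ≅ N
    from M≅N* = ≅-trans (dual-cong M≅N*) (≅-sym (≅-dual-dual isN))

  D-InA : ∀ {𝓐 𝓑 : RawMatroid → Set} → (∀ {M} → 𝓑 M → 𝓐 (dual M)) → ∀ x → InA 𝓐 x → InA 𝓑 (D x)
  D-InA dual-𝓑⊆𝓐 x (invariant , bound , vanishes) =
    (λ M N M∈𝓑 M≅N → invariant (dual M) (dual N) (dual-𝓑⊆𝓐 M∈𝓑) (dual-cong M≅N)) ,
    bound , λ M M∈𝓑 → vanishes (dual M) (dual-𝓑⊆𝓐 M∈𝓑)

  module _ {𝓜 𝓝 : RawMatroid → Set} (mc : MinorClosedClass 𝓜)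
           (𝓝-isMatroid : ∀ {M} → 𝓝 M → IsMatroid M)
           (dual-𝓝⊆𝓜 : ∀ {M} → 𝓝 M → 𝓜 (dual M))
           (dual-𝓜⊆𝓝 : ∀ {M} → 𝓜 M → 𝓝 (dual M)) where
    open MinorClosedClass mc

    D-anti-mult : ∀ x y → InA 𝓜 x → InA 𝓜 y → Eq 𝓝 (D (x · y)) (D y · D x)
    D-anti-mult x y (x-inv , _) (y-inv , _) M M∈𝓝 = begin
      (x · y) (dual M)
        ≈⟨ ·-coefficient (dual M) {x} {y} (λ B⊆E → x-inv _ _ (restr-closed _ _ M*∈𝓜 B⊆E))
                                  (λ B⊆E → y-inv _ _ (contr-closed _ _ M*∈𝓜 B⊆E)) ⟩
      ∑ (subsetsOf S) (λ B → x (restrict (dual M) B) *K y (contract (dual M) B))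
        ≈⟨ ∑-complement S _ ⟨
      ∑ (subsetsOf S) (λ A → x (restrict (dual M) (S ─ A)) *K y (contract (dual M) (S ─ A)))
        ≈⟨ ∑-cong (All.map complement-summand (all-filter (_⊆? S) (subsets (n M)))) ⟩
      ∑ (subsetsOf S) (λ A → y (dual (restrict M A)) *K x (dual (contract M A)))
        ≈⟨ ·-coefficient M {D y} {D x} (λ A⊆E res≅ → y-inv _ _ (M|A*∈𝓜 A⊆E) (dual-cong res≅))
                           (λ A⊆E con≅ → x-inv _ _ (M/A*∈𝓜 A⊆E) (dual-cong con≅)) ⟨
      (D y · D x) M ∎
      where
      S = E M
      isM = 𝓝-isMatroid M∈𝓝
      M*∈𝓜 = dual-𝓝⊆𝓜 M∈𝓝
      M*|[S─A]∈𝓜 : ∀ {A} → 𝓜 (restrict (dual M) (S ─ A))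
      M*|[S─A]∈𝓜 = restr-closed _ _ M*∈𝓜 (p─q⊆p S _)
      M*/[S─A]∈𝓜 : ∀ {A} → 𝓜 (contract (dual M) (S ─ A))
      M*/[S─A]∈𝓜 = contr-closed _ _ M*∈𝓜 (p─q⊆p S _)
      M|A*∈𝓜 : ∀ {A} → A ⊆ S → 𝓜 (dual (restrict M A))
      M|A*∈𝓜 A⊆S = iso-closed _ _ M*/[S─A]∈𝓜 (contract-dual≅dual-restrict isM _ A⊆S)
      M/A*∈𝓜 : ∀ {A} → A ⊆ S → 𝓜 (dual (contract M A))
      M/A*∈𝓜 A⊆S = iso-closed _ _ M*|[S─A]∈𝓜 (restrict-dual≅dual-contract isM _ A⊆S)
      complement-summand : ∀ {A} → A ⊆ S → x (restrict (dual M) (S ─ A)) *K y (contract (dual M) (S ─ A))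
                                             ≈ y (dual (restrict M A)) *K x (dual (contract M A))
      complement-summand A⊆S =
        ≈-trans (*-cong (x-inv _ _ M*|[S─A]∈𝓜 (restrict-dual≅dual-contract isM _ A⊆S))
                        (y-inv _ _ M*/[S─A]∈𝓜 (contract-dual≅dual-restrict isM _ A⊆S)))
                (*-comm _ _)

    D-isDualAntiIso : IsDualAntiIso 𝓜 𝓝 D
    D-isDualAntiIso = record
      { into       = D-InA dual-𝓝⊆𝓜
      ; well-def   = λ _ _ _ _ x≈y M M∈𝓝 → x≈y (dual M) (dual-𝓝⊆𝓜 M∈𝓝)
      ; additive   = λ _ _ _ _ _ _ → ≈-refl
      ; homogen    = λ _ _ _ _ _ → ≈-refl
      ; on-basis   = λ N N∈𝓜 M M∈𝓝 → ≈-reflexive (basis-dual (𝓝-isMatroid M∈𝓝) (matroids N N∈𝓜))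
      ; injective  = λ x y (x-inv , _) (y-inv , _) Dx≈Dy M M∈𝓜 →
          let M≅M** = ≅-dual-dual (matroids M M∈𝓜) in
          ≈-trans (x-inv _ _ M∈𝓜 M≅M**)
                  (≈-trans (Dx≈Dy (dual M) (dual-𝓜⊆𝓝 M∈𝓜)) (≈-sym (y-inv _ _ M∈𝓜 M≅M**)))
      ; surjective = λ z z∈𝒜@(z-inv , _) → D z , D-InA dual-𝓜⊆𝓝 z z∈𝒜 ,
          λ M M∈𝓝 → ≈-sym (z-inv _ _ M∈𝓝 (≅-dual-dual (𝓝-isMatroid M∈𝓝)))
      ; unital     = λ M M∈𝓝 → ≈-reflexive (trans (basis-dual (𝓝-isMatroid M∈𝓝) empty-isMatroid)
                                                   (basis-resp-≅ M dual-empty≅empty))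
      ; anti-mult  = D-anti-mult
      }

proposition3p1 : {c ℓ : Level} (K : CommutativeRing c ℓ) (𝓜 : RawMatroid → Set) →
    MinorClosedClass 𝓜 →
    Σ (Algebra.Coef K → Algebra.Coef K) (λ D →
      Algebra.IsDualAntiIso K 𝓜 (DualClass 𝓜) D
      × ((∀ M → 𝓜 M → 𝓜 (dual M)) → Algebra.IsDualAntiIso K 𝓜 𝓜 D))
proposition3p1 K 𝓜 mc =
  D K ,
  D-isDualAntiIso K mc (DualClass-isMatroid mc) (DualClass-dual mc) dual-DualClass ,
  λ dual-closed → D-isDualAntiIso K mc (matroids _) (dual-closed _) (dual-closed _)
  where open MinorClosedClass mc
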